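{- For positive integers $d_1,\dots,d_t$, let $H$ be the 1-uniform multigraph $(d_1,\dots,d_t)$ and let $S_{d_1,\dots,d_t}$ be the multi-star. Then $\mathcal{E}^*_{S_{d_1,\dots,d_t}}(k)=\mathcal{E}^*_H(k)$ for every positive integer $k$, where the left side is taken over 2-uniform multigraph hosts and the right side over 1-uniform multigraph hosts.
   Context: A 1-uniform multigraph on $n$ vertices is identified with its sequence $(x_1,\dots,x_n)$, where $x_i$ is the number of loops (edges of size 1) at vertex $i$; $(d_1,\dots,d_t)\subseteq(x_1,\dots,x_n)$ iff there is an injection $f:[t]\to[n]$ with $d_i\leq x_{f(i)}$ for all $i$. The multi-star $S_{d_1,\dots,d_t}$ is a star on $t+1$ vertices whose $t$ edges have multiplicities $d_1,\dots,d_t$. $\operatorname{ex}(G,F)$ is the maximum number of edges (with multiplicity) of a subgraph of $G$ with no copy of $F$, and $\mathcal{E}^*_F(k):=\sup\{e(G): G \text{ a multigraph of the same uniformity as } F, \operatorname{ex}(G,F)<k\}$. -}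

module Defs where

open import Data.Nat using (ℕ; zero; suc; _+_; _≤_; _<_; _<ᵇ_)
open import Data.Fin using (Fin; toℕ)
import Data.Fin as F
open import Data.Bool using (if_then_else_)
open import Data.Product using (Σ; ∃; _×_)
open import Relation.Binary.PropositionalEquality using (_≡_; _≢_)
open import Relation.Nullary using (¬_)
open import Function.Definitions using (Injective)

sumFin : (n : ℕ) → (Fin n → ℕ) → ℕ
sumFin zero    f = 0
sumFin (suc n) f = f F.zero + sumFin n (λ i → f (F.suc i))

-- 1-uniform multigraphs: (x_1,...,x_n), x_i = number of loops at vertex i

MG1 : ℕ → Set
MG1 n = Fin n → ℕ

e1 : {n : ℕ} → MG1 n → ℕ
e1 {n} x = sumFin n x

_⊆₁_ : {n : ℕ} → MG1 n → MG1 n → Set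
y ⊆₁ x = ∀ i → y i ≤ x i

Contains1 : {t n : ℕ} → (Fin t → ℕ) → MG1 n → Set
Contains1 {t} {n} d x =
  Σ (Fin t → Fin n) λ f → Injective _≡_ _≡_ f × (∀ i → d i ≤ x (f i))

-- ex(G,H) < k : every H-free subgraph of G has fewer than k edges
ExLess1 : {t n : ℕ} → (Fin t → ℕ) → MG1 n → ℕ → Set
ExLess1 d x k = ∀ y → y ⊆₁ x → ¬ Contains1 d y → e1 y < k

record MG2 (n : ℕ) : Set where
  field
    mult   : Fin n → Fin n → ℕ
    sym    : ∀ i j → mult i j ≡ mult j i
    noLoop : ∀ i → mult i i ≡ 0
open MG2 public

e2 : {n : ℕ} → MG2 n → ℕ
e2 {n} G = sumFin n λ i → sumFin n λ j →
  if toℕ i <ᵇ toℕ j then mult G i j else 0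

_⊆₂_ : {n : ℕ} → MG2 n → MG2 n → Set
G' ⊆₂ G = ∀ i j → mult G' i j ≤ mult G i j

ContainsStar : {t n : ℕ} → (Fin t → ℕ) → MG2 n → Set
ContainsStar {t} {n} d G =
  Σ (Fin n) λ c → Σ (Fin t → Fin n) λ f →
    Injective _≡_ _≡_ f × (∀ i → f i ≢ c) × (∀ i → d i ≤ mult G c (f i))

ExLessStar : {t n : ℕ} → (Fin t → ℕ) → MG2 n → ℕ → Set
ExLessStar d G k = ∀ G' → G' ⊆₂ G → ¬ ContainsStar d G' → e2 G' < k

-- E*_F(k) = sup { e(G) : ex(G,F) < k } ∈ ℕ ∪ {∞}.  Since sup-values live in
-- ℕ ∪ {∞}, we describe them by the predicate  "N ≤ E*_F(k)", i.e.
-- there is a host G with ex(G,F) < k and e(G) ≥ N.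

EStarAtLeast1 : {t : ℕ} → (Fin t → ℕ) → ℕ → ℕ → Set
EStarAtLeast1 d k N = Σ ℕ λ n → Σ (MG1 n) λ x → ExLess1 d x k × N ≤ e1 x

EStarAtLeastStar : {t : ℕ} → (Fin t → ℕ) → ℕ → ℕ → Set
EStarAtLeastStar d k N = Σ ℕ λ n → Σ (MG2 n) λ G → ExLessStar d G k × N ≤ e2 G

-- A 1-uniform host (x_1,…,x_n) is the same as the multi-star whose leaf multiplicities are
-- the x_i: its subgraphs are again such stars, and such a star contains S_{d_1,…,d_t}
-- exactly when (d_1,…,d_t) ⊆ (x_1,…,x_n). Conversely, a 2-uniform host G becomes the
-- 1-uniform host with one vertex per pair {i,j} carrying its multiplicity. Its subgraphs
-- are subgraphs of G with the same number of edges, and a copy of S_{d_1,…,d_t} with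
-- centre c and leaves a_1,…,a_t gives the distinct vertices {c,a_1},…,{c,a_t} carrying at
-- least d_1,…,d_t loops. Both reductions preserve e(G) and ex(G,F) < k.
module Submission where

open import Defs hiding (sym)
open import Data.Nat using (ℕ; zero; suc; _+_; _*_; _≤_; _<_; z≤n; _<ᵇ_)
open import Data.Nat.Properties using (≤-refl; ≤-trans; n≤0⇒n≡0; +-assoc; +-identityʳ)
open import Data.Fin using (Fin; toℕ; combine; remQuot; _↑ˡ_; _↑ʳ_)
import Data.Fin as F
open import Data.Fin.Properties using (remQuot-combine; suc-injective)
open import Data.Bool using (true; false; if_then_else_)
open import Data.Product using (_×_; _,_; proj₁; proj₂; uncurry)
open import Data.Empty using (⊥-elim)
open import Relation.Binary.PropositionalEquality
  using (_≡_; _≢_; refl; sym; trans; cong; cong₂; subst)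
open import Function.Bundles using (_⇔_; mk⇔)

private
  variable
    m n t : ℕ

sumFin-cong : {f g : Fin n → ℕ} → (∀ i → f i ≡ g i) → sumFin n f ≡ sumFin n g
sumFin-cong {zero}  f≗g = refl
sumFin-cong {suc n} f≗g = cong₂ _+_ (f≗g F.zero) (sumFin-cong (λ i → f≗g (F.suc i)))

sumFin-zero : {f : Fin n → ℕ} → (∀ i → f i ≡ 0) → sumFin n f ≡ 0
sumFin-zero {zero}  f≗0 = refl
sumFin-zero {suc n} f≗0 rewrite f≗0 F.zero = sumFin-zero (λ i → f≗0 (F.suc i))

sumFin-↑ : (f : Fin (m + n) → ℕ) →
  sumFin (m + n) f ≡ sumFin m (λ i → f (i ↑ˡ n)) + sumFin n (λ j → f (m ↑ʳ j))
sumFin-↑ {zero}  f = refl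
sumFin-↑ {suc m} f rewrite sumFin-↑ {m} (λ i → f (F.suc i)) = sym (+-assoc (f F.zero) _ _)

sumFin-combine : (f : Fin (m * n) → ℕ) →
  sumFin (m * n) f ≡ sumFin m (λ i → sumFin n (λ j → f (combine i j)))
sumFin-combine {zero}      f = refl
sumFin-combine {suc m} {n} f =
  trans (sumFin-↑ {n} f)
        (cong (sumFin n (λ j → f (j ↑ˡ m * n)) +_) (sumFin-combine {m} (λ p → f (n ↑ʳ p))))

<ᵇ-irrefl : ∀ a → (a <ᵇ a) ≡ false
<ᵇ-irrefl zero    = refl
<ᵇ-irrefl (suc a) = <ᵇ-irrefl a

<ᵇ-asym : ∀ a b → (a <ᵇ b) ≡ true → (b <ᵇ a) ≡ false
<ᵇ-asym zero    zero    ()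
<ᵇ-asym zero    (suc b) p = refl
<ᵇ-asym (suc a) (suc b) p = <ᵇ-asym a b p

if-0≤ : ∀ b a → (if b then a else 0) ≤ a
if-0≤ true  a = ≤-refl
if-0≤ false a = z≤n

combine-injective : (i i′ : Fin m) (j j′ : Fin n) →
  combine i j ≡ combine i′ j′ → i ≡ i′ × j ≡ j′
combine-injective {m} {n} i i′ j j′ eq =
  let pairs≡ = trans (sym (remQuot-combine {m} {n} i j))
                     (trans (cong (remQuot n) eq) (remQuot-combine i′ j′))
  in cong proj₁ pairs≡ , cong proj₂ pairs≡

star : MG1 n → MG2 (suc n)
star {n} x = record { mult = weight ; sym = weight-sym ; noLoop = weight-noLoop }
  where
  weight : Fin (suc n) → Fin (suc n) → ℕ
  weight F.zero    F.zero    = 0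
  weight F.zero    (F.suc j) = x j
  weight (F.suc i) F.zero    = x i
  weight (F.suc i) (F.suc _) = 0

  weight-sym : ∀ i j → weight i j ≡ weight j i
  weight-sym F.zero    F.zero    = refl
  weight-sym F.zero    (F.suc j) = refl
  weight-sym (F.suc i) F.zero    = refl
  weight-sym (F.suc i) (F.suc j) = refl

  weight-noLoop : ∀ i → weight i i ≡ 0
  weight-noLoop F.zero    = refl
  weight-noLoop (F.suc i) = refl

leaves : MG2 (suc n) → MG1 n
leaves H j = mult H F.zero (F.suc j)

e2-centred : (H : MG2 (suc n)) → (∀ i j → mult H (F.suc i) (F.suc j) ≡ 0) →
  e2 H ≡ e1 (leaves H)
e2-centred {n} H no-rim =
  trans (cong (e1 (leaves H) +_) (sumFin-zero λ i → sumFin-zero λ j → below i j))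
        (+-identityʳ _)
  where
  below : ∀ i j →
    (if toℕ (F.suc i) <ᵇ toℕ (F.suc j) then mult H (F.suc i) (F.suc j) else 0) ≡ 0
  below i j rewrite no-rim i j with toℕ i <ᵇ toℕ j
  ... | true  = refl
  ... | false = refl

Contains1-leaves⇒ContainsStar : (d : Fin t → ℕ) (H : MG2 (suc n)) →
  Contains1 d (leaves H) → ContainsStar d H
Contains1-leaves⇒ContainsStar d H (f , f-inj , d≤) =
  F.zero , (λ i → F.suc (f i)) , (λ eq → f-inj (suc-injective eq)) , (λ i ()) , d≤

ExLess1⇒ExLessStar-star : (d : Fin t → ℕ) (x : MG1 n) {k : ℕ} →
  ExLess1 d x k → ExLessStar d (star x) k
ExLess1⇒ExLessStar-star d x ex H H⊆ H-free =
  subst (_< _) (sym (e2-centred H λ i j → n≤0⇒n≡0 (H⊆ (F.suc i) (F.suc j))))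
        (ex (leaves H) (λ j → H⊆ F.zero (F.suc j))
            (λ c → H-free (Contains1-leaves⇒ContainsStar d H c)))

upper : (Fin n → Fin n → ℕ) → Fin n → Fin n → ℕ
upper w i j = if toℕ i <ᵇ toℕ j then w i j else 0

flatten : (Fin m → Fin n → ℕ) → MG1 (m * n)
flatten {n = n} w p = uncurry w (remQuot n p)

flatten-combine : (w : Fin m → Fin n → ℕ) (i : Fin m) (j : Fin n) →
  flatten w (combine i j) ≡ w i j
flatten-combine w i j = cong (uncurry w) (remQuot-combine i j)

e1-flatten : (w : Fin m → Fin n → ℕ) → e1 (flatten w) ≡ sumFin m (λ i → sumFin n (w i))
e1-flatten {m} w =
  trans (sumFin-combine {m} (flatten w))
        (sumFin-cong λ i → sumFin-cong λ j → flatten-combine w i j)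

pair : Fin n → Fin n → Fin (n * n)
pair c a = if toℕ c <ᵇ toℕ a then combine c a else combine a c

pair-injective : (c a b : Fin n) → a ≢ c → b ≢ c → pair c a ≡ pair c b → a ≡ b
pair-injective c a b a≢c b≢c eq with toℕ c <ᵇ toℕ a | toℕ c <ᵇ toℕ b
... | true  | true  = proj₂ (combine-injective c c a b eq)
... | true  | false = ⊥-elim (b≢c (sym (proj₁ (combine-injective c b a c eq))))
... | false | true  = ⊥-elim (a≢c (proj₁ (combine-injective a c c b eq)))
... | false | false = proj₁ (combine-injective a b c c eq)

-- The pair {i,j} with i < j is the vertex combine i j; the entries of y at combine i j
-- with i ≥ j are ignored, and vanish for subgraphs of flatten (upper w).
unflatten : MG1 (n * n) → MG2 n
unflatten {n} y = record { mult = weight ; sym = weight-sym ; noLoop = weight-noLoop }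
  where
  weight : Fin n → Fin n → ℕ
  weight i j = if toℕ i <ᵇ toℕ j then y (combine i j)
               else (if toℕ j <ᵇ toℕ i then y (combine j i) else 0)

  weight-sym : ∀ i j → weight i j ≡ weight j i
  weight-sym i j with toℕ i <ᵇ toℕ j in i<j | toℕ j <ᵇ toℕ i in j<i
  ... | true  | true  with () ← trans (sym j<i) (<ᵇ-asym (toℕ i) (toℕ j) i<j)
  ... | true  | false = refl
  ... | false | true  = refl
  ... | false | false = refl

  weight-noLoop : ∀ i → weight i i ≡ 0
  weight-noLoop i rewrite <ᵇ-irrefl (toℕ i) = refl

unflatten≤pair : (y : MG1 (n * n)) (c a : Fin n) → mult (unflatten {n} y) c a ≤ y (pair c a)
unflatten≤pair y c a with toℕ c <ᵇ toℕ a
... | true  = ≤-refl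
... | false = if-0≤ (toℕ a <ᵇ toℕ c) _

ContainsStar-unflatten⇒Contains1 : (d : Fin t → ℕ) (y : MG1 (n * n)) →
  ContainsStar d (unflatten {n} y) → Contains1 d y
ContainsStar-unflatten⇒Contains1 {n = n} d y (c , f , f-inj , f≢c , d≤) =
  (λ i → pair c (f i)) ,
  (λ {i} {j} eq → f-inj (pair-injective c (f i) (f j) (f≢c i) (f≢c j) eq)) ,
  (λ i → ≤-trans (d≤ i) (unflatten≤pair {n} y c (f i)))

module _ (G : MG2 n) (y : MG1 (n * n)) (y⊆ : y ⊆₁ flatten (upper (mult G))) where

  private
    y≤upper : ∀ i j → y (combine i j) ≤ upper (mult G) i j
    y≤upper i j =
      subst (y (combine i j) ≤_) (flatten-combine (upper (mult G)) i j) (y⊆ (combine i j))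

  unflatten-⊆ : unflatten {n} y ⊆₂ G
  unflatten-⊆ i j with toℕ i <ᵇ toℕ j | y≤upper i j
  ... | true  | y≤G = y≤G
  ... | false | _ with toℕ j <ᵇ toℕ i | y≤upper j i
  ...   | true  | y≤G = subst (y (combine j i) ≤_) (MG2.sym G j i) y≤G
  ...   | false | _   = z≤n

  e1≡e2-unflatten : e1 y ≡ e2 (unflatten {n} y)
  e1≡e2-unflatten =
    trans (sumFin-combine {n} y) (sumFin-cong λ i → sumFin-cong λ j → y≡upper i j)
    where
    y≡upper : ∀ i j → y (combine i j) ≡ upper (mult (unflatten {n} y)) i j
    y≡upper i j with toℕ i <ᵇ toℕ j | y≤upper i j
    ... | true  | _   = refl
    ... | false | y≤0 = n≤0⇒n≡0 y≤0

ExLessStar⇒ExLess1-flatten : (d : Fin t → ℕ) (G : MG2 n) {k : ℕ} →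
  ExLessStar d G k → ExLess1 d (flatten (upper (mult G))) k
ExLessStar⇒ExLess1-flatten d G ex y y⊆ y-free =
  subst (_< _) (sym (e1≡e2-unflatten G y y⊆))
        (ex (unflatten y) (unflatten-⊆ G y y⊆)
            (λ s → y-free (ContainsStar-unflatten⇒Contains1 d y s)))

lemma5p1 : (t : ℕ) (d : Fin t → ℕ) → (∀ i → 0 < d i) →
    (k : ℕ) → 0 < k →
    ∀ N → EStarAtLeastStar d k N ⇔ EStarAtLeast1 d k N
lemma5p1 t d _ k _ N = mk⇔ star⇒loops loops⇒star
  where
  star⇒loops : EStarAtLeastStar d k N → EStarAtLeast1 d k N
  star⇒loops (n , G , ex , N≤) =
    n * n , flatten (upper (mult G)) , ExLessStar⇒ExLess1-flatten d G ex ,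
    subst (N ≤_) (sym (e1-flatten (upper (mult G)))) N≤

  loops⇒star : EStarAtLeast1 d k N → EStarAtLeastStar d k N
  loops⇒star (n , x , ex , N≤) =
    suc n , star x , ExLess1⇒ExLessStar-star d x ex ,
    subst (N ≤_) (sym (e2-centred (star x) λ i j → refl)) N≤
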